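{- Let $H$ be an adjacency $k$-resolved graph of order $n_2$ and let $G$ be a non-trivial graph of diameter $D(G)<k$. Then $\dim_l(G\boxtimes H)\le n_2\cdot \dim_l(G)$.
   Context: All graphs are finite, simple and connected; $d_G$ is the shortest-path distance and $D(G)$ the diameter. A set $S\subseteq V(G)$ is a local metric generator for $G$ if for every two adjacent vertices $x,y$ there is $s\in S$ with $d_G(s,x)\ne d_G(s,y)$; $\dim_l(G)$ is the minimum cardinality of a local metric generator. The strong product $G\boxtimes H$ has vertex set $V(G)\times V(H)$, with $(a,b)\sim(c,d)$ iff ($a=c$ and $b\sim d$) or ($b=d$ and $a\sim c$) or ($a\sim c$ and $b\sim d$). For $x,y\in V(G)$, the interval $I[x,y]$ is the set of vertices lying on some shortest $x$–$y$ path. For a nonnegative integer $k$, a graph $G$ is adjacency $k$-resolved if for every two adjacent vertices $x,y$ there is $w\in V(G)$ such that ($d_G(y,w)\ge k$ and $x\in I[y,w]$) or ($d_G(x,w)\ge k$ and $y\in I[x,w]$). -}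

module Defs where

open import Data.Nat using (ℕ; zero; suc; _+_; _≤_; _<_)
open import Data.Fin using (Fin; remQuot)
open import Data.Fin.Subset using (Subset; _∈_; ∣_∣)
open import Data.Product using (Σ; ∃; _×_; _,_; proj₁; proj₂)
open import Data.Sum using (_⊎_)
open import Relation.Binary.PropositionalEquality using (_≡_; _≢_)
open import Relation.Nullary using (¬_; Dec)

record Graph : Set₁ where
  field
    order : ℕ
    Adj   : Fin order → Fin order → Set

open Graph public

data Walk (G : Graph) : Fin (order G) → Fin (order G) → ℕ → Set where
  here : ∀ x → Walk G x x 0
  step : ∀ {x y z k} → Adj G x y → Walk G y z k → Walk G x z (suc k)

record IsSimpleConnected (G : Graph) : Set where
  field
    adj?      : ∀ x y → Dec (Adj G x y)
    adj-sym   : ∀ {x y} → Adj G x y → Adj G y x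
    adj-irr   : ∀ {x} → ¬ Adj G x x
    connected : ∀ x y → ∃ λ k → Walk G x y k

IsDist : (G : Graph) → Fin (order G) → Fin (order G) → ℕ → Set
IsDist G x y d = Walk G x y d × (∀ m → Walk G x y m → d ≤ m)

IsDiameter : Graph → ℕ → Set
IsDiameter G D =
  (∃ λ x → ∃ λ y → IsDist G x y D) ×
  (∀ x y d → IsDist G x y d → d ≤ D)

-- x ∈ I[y,w] : x lies on some shortest y–w path.
InInterval : (G : Graph) → (x y w : Fin (order G)) → Set
InInterval G x y w =
  ∃ λ a → ∃ λ b → Walk G y x a × Walk G x w b × IsDist G y w (a + b)

IsLocalMetricGenerator : (G : Graph) → Subset (order G) → Set
IsLocalMetricGenerator G S =
  ∀ x y → Adj G x y →
    ∃ λ s → s ∈ S × (∃ λ d₁ → ∃ λ d₂ → IsDist G s x d₁ × IsDist G s y d₂ × d₁ ≢ d₂)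

IsLocalMetricDim : Graph → ℕ → Set
IsLocalMetricDim G m =
  (∃ λ S → IsLocalMetricGenerator G S × ∣ S ∣ ≡ m) ×
  (∀ S → IsLocalMetricGenerator G S → m ≤ ∣ S ∣)

AdjacencyResolved : ℕ → Graph → Set
AdjacencyResolved k G =
  ∀ x y → Adj G x y → ∃ λ w →
    ((∃ λ d → IsDist G y w d × k ≤ d) × InInterval G x y w) ⊎
    ((∃ λ d → IsDist G x w d × k ≤ d) × InInterval G y x w)

-- Strong product; vertex (a,b) is encoded as combine a b : Fin (n₁ * n₂).
data StrongAdj (G H : Graph) (a : Fin (order G)) (b : Fin (order H))
               (c : Fin (order G)) (d : Fin (order H)) : Set where
  same₁ : a ≡ c → Adj H b d → StrongAdj G H a b c d
  same₂ : b ≡ d → Adj G a c → StrongAdj G H a b c d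
  both  : Adj G a c → Adj H b d → StrongAdj G H a b c d

_⊠_ : Graph → Graph → Graph
G ⊠ H = record
  { order = order G Data.Nat.* order H
  ; Adj   = λ u v → StrongAdj G H (proj₁ (remQuot {order G} (order H) u)) (proj₂ (remQuot {order G} (order H) u))
                                   (proj₁ (remQuot {order G} (order H) v)) (proj₂ (remQuot {order G} (order H) v))
  }

-- The generator S × V(H) works. Pairs with the same H-coordinate are resolved
-- by (s, b) for the vertex s ∈ S resolving their G-coordinates, because
-- d((s,b),(x,b)) = d_G(s,x). For pairs with adjacent H-coordinates b ~ d choose
-- w with, say, b ∈ I[d,w] and d_H(d,w) ≥ k, and any s ∈ S: since distances in
-- G⊠H are the maxima of the coordinate distances and every G-distance is at
-- most D(G) < k ≤ d_H(d,w) = d_H(b,w) + 1, the vertex (s,w) sees the two ends at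
-- distances d_H(b,w) and d_H(b,w) + 1.
module Submission where

open import Defs
open import Data.Nat using (ℕ; zero; suc; _+_; _*_; _⊔_; _≤_; _<_; _≥_; z≤n; s≤s; s≤s⁻¹)
open import Data.Nat.Properties
open import Data.Fin using (Fin; toℕ; fromℕ; fromℕ<; combine; remQuot)
import Data.Fin.Properties as Fin
open import Data.Fin.Subset using (Subset; _∈_; ∣_∣; inside; outside)
open import Data.Fin.Subset.Properties using (∣⊤∣≡n; ∣⊥∣≡0)
open import Data.Vec using ([]; _∷_; _++_; replicate; concat; map; lookup)
import Data.Vec.Properties as Vec
open import Data.Product using (∃; _×_; _,_; proj₁; proj₂)
open import Data.Sum using (inj₁; inj₂)
open import Function using (_∘_)
open import Relation.Binary.PropositionalEquality
open import Relation.Nullary using (¬_; ¬?; Dec; yes; no; contradiction)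
open import Relation.Nullary.Decidable using (map′; _×-dec_; decidable-stable)

Walk-snoc : ∀ {G x y z n} → Walk G x y n → Adj G y z → Walk G x z (suc n)
Walk-snoc (here x)   yz = step yz (here _)
Walk-snoc (step a w) yz = step a (Walk-snoc w yz)

Walk-reverse : ∀ {G} → (∀ {x y} → Adj G x y → Adj G y x) →
               ∀ {x y n} → Walk G x y n → Walk G y x n
Walk-reverse sym (here x)   = here x
Walk-reverse sym (step a w) = Walk-snoc (Walk-reverse sym w) (sym a)

IsDist-refl : ∀ {G} x → IsDist G x x 0
IsDist-refl x = here x , λ _ _ → z≤n

IsDist-sym : ∀ {G} → (∀ {x y} → Adj G x y → Adj G y x) →
             ∀ {x y d} → IsDist G x y d → IsDist G y x d
IsDist-sym sym (w , shortest) = Walk-reverse sym w , λ m → shortest m ∘ Walk-reverse sym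

IsDist-functional : ∀ {G x y d d′} → IsDist G x y d → IsDist G x y d′ → d ≡ d′
IsDist-functional {d = d} {d′} (w , shortest) (w′ , shortest′) =
  ≤-antisym (shortest d′ w′) (shortest′ d w)

module _ {G : Graph} (sc : IsSimpleConnected G) where
  open IsSimpleConnected sc

  walk? : ∀ x y n → Dec (Walk G x y n)
  walk? x y zero with x Fin.≟ y
  ... | yes refl = yes (here x)
  ... | no x≢y   = no λ { (here _) → x≢y refl }
  walk? x y (suc n) =
    map′ (λ { (z , a , w) → step a w }) (λ { (step a w) → _ , a , w })
         (Fin.any? λ z → adj? x z ×-dec walk? z y n)

  -- The least i ≤ n admitting a walk of length i is the distance.
  IsDist-exists : ∀ x y → ∃ λ d → IsDist G x y d
  IsDist-exists x y with connected x y
  ... | n , w with Fin.¬∀⟶∃¬-smallest (suc n) (λ i → ¬ Walk G x y (toℕ i))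
                     (λ i → ¬? (walk? x y (toℕ i)))
                     (λ none → none (fromℕ n) (subst (Walk G x y) (sym (Fin.toℕ-fromℕ n)) w))
  ... | i , ¬¬walk , shorter = toℕ i , decidable-stable (walk? x y (toℕ i)) ¬¬walk , least
    where
      least : ∀ m → Walk G x y m → toℕ i ≤ m
      least m wm = ≮⇒≥ λ m<i →
        shorter (fromℕ< m<i)
          (subst (Walk G x y) (sym (trans (Fin.toℕ-inject (fromℕ< m<i)) (Fin.toℕ-fromℕ< m<i))) wm)

  IsDist-interval : ∀ {x y w} → Adj G x y → InInterval G x y w →
                    ∃ λ β → IsDist G x w β × IsDist G y w (suc β)
  IsDist-interval xy (zero , b , here _ , _ , _) = contradiction xy adj-irr
  IsDist-interval xy (suc a , b , _ , xw , (_ , shortest)) =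
      b
    , (xw , λ m wm → ≤-trans (m≤n+m b a) (s≤s⁻¹ (shortest (suc m) (step (adj-sym xy) wm))))
    , (step (adj-sym xy) xw , λ m wm → ≤-trans (s≤s (m≤n+m b a)) (shortest m wm))

  edge-exists : order G ≥ 2 → ∃ λ x → ∃ λ y → Adj G x y
  edge-exists 2≤n = first-edge (proj₂ (connected x₀ x₁)) x₀≢x₁
    where
      x₀ x₁ : Fin (order G)
      x₀ = fromℕ< {0} (≤-trans (s≤s z≤n) 2≤n)
      x₁ = fromℕ< {1} 2≤n

      x₀≢x₁ : x₀ ≢ x₁
      x₀≢x₁ eq with trans (sym (Fin.toℕ-fromℕ< _)) (trans (cong toℕ eq) (Fin.toℕ-fromℕ< 2≤n))
      ... | ()

      first-edge : ∀ {x y n} → Walk G x y n → x ≢ y → ∃ λ a → ∃ λ b → Adj G a b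
      first-edge (here _)   x≢x = contradiction refl x≢x
      first-edge (step a _) _   = _ , _ , a

module Strong (G H : Graph) where
  π₁ : Fin (order (G ⊠ H)) → Fin (order G)
  π₁ u = proj₁ (remQuot {order G} (order H) u)

  π₂ : Fin (order (G ⊠ H)) → Fin (order H)
  π₂ u = proj₂ (remQuot {order G} (order H) u)

  combine-π : ∀ u → combine (π₁ u) (π₂ u) ≡ u
  combine-π = Fin.combine-remQuot {order G} (order H)

  ⊠-adj : ∀ {a b c d} → StrongAdj G H a b c d → Adj (G ⊠ H) (combine a b) (combine c d)
  ⊠-adj {a} {b} {c} {d} =
    subst₂ (λ p q → StrongAdj G H (proj₁ p) (proj₂ p) (proj₁ q) (proj₂ q))
      (sym (Fin.remQuot-combine a b)) (sym (Fin.remQuot-combine c d))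

  ⊠-walkˡ : ∀ {a b c e} → Walk G a c e → Walk (G ⊠ H) (combine a b) (combine c b) e
  ⊠-walkˡ (here a)   = here _
  ⊠-walkˡ (step g w) = step (⊠-adj (same₂ refl g)) (⊠-walkˡ w)

  ⊠-walk : ∀ {a b c d e f} → Walk G a c e → Walk H b d f →
           Walk (G ⊠ H) (combine a b) (combine c d) (e ⊔ f)
  ⊠-walk (here a)   (here b)    = here _
  ⊠-walk (here a)   (step h w)  = step (⊠-adj (same₁ refl h)) (⊠-walk (here a) w)
  ⊠-walk (step g w) (here b)    = step (⊠-adj (same₂ refl g)) (⊠-walkˡ w)
  ⊠-walk (step g w) (step h w′) = step (⊠-adj (both g h)) (⊠-walk w w′)

  π₁-walk : ∀ {u v m} → Walk (G ⊠ H) u v m → ∃ λ l → Walk G (π₁ u) (π₁ v) l × l ≤ m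
  π₁-walk (here u) = 0 , here _ , z≤n
  π₁-walk (step (same₁ a≡c _) w) with π₁-walk w
  ... | l , w′ , l≤m = l , subst (λ x → Walk G x _ l) (sym a≡c) w′ , m≤n⇒m≤1+n l≤m
  π₁-walk (step (same₂ _ g) w) with π₁-walk w
  ... | l , w′ , l≤m = suc l , step g w′ , s≤s l≤m
  π₁-walk (step (both g _) w) with π₁-walk w
  ... | l , w′ , l≤m = suc l , step g w′ , s≤s l≤m

  π₂-walk : ∀ {u v m} → Walk (G ⊠ H) u v m → ∃ λ l → Walk H (π₂ u) (π₂ v) l × l ≤ m
  π₂-walk (here u) = 0 , here _ , z≤n
  π₂-walk (step (same₂ b≡d _) w) with π₂-walk w
  ... | l , w′ , l≤m = l , subst (λ x → Walk H x _ l) (sym b≡d) w′ , m≤n⇒m≤1+n l≤m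
  π₂-walk (step (same₁ _ h) w) with π₂-walk w
  ... | l , w′ , l≤m = suc l , step h w′ , s≤s l≤m
  π₂-walk (step (both _ h) w) with π₂-walk w
  ... | l , w′ , l≤m = suc l , step h w′ , s≤s l≤m

  ⊠-dist : ∀ {u v e f} → IsDist G (π₁ u) (π₁ v) e → IsDist H (π₂ u) (π₂ v) f →
           IsDist (G ⊠ H) u v (e ⊔ f)
  ⊠-dist {u} {v} {e} {f} (wG , shortestG) (wH , shortestH) =
    subst₂ (λ x y → Walk (G ⊠ H) x y (e ⊔ f)) (combine-π u) (combine-π v) (⊠-walk wG wH) ,
    λ m w → ⊔-lub (shortest₁ m w) (shortest₂ m w)
    where
      shortest₁ : ∀ m → Walk (G ⊠ H) u v m → e ≤ m
      shortest₁ m w with π₁-walk w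
      ... | l , w′ , l≤m = ≤-trans (shortestG l w′) l≤m
      shortest₂ : ∀ m → Walk (G ⊠ H) u v m → f ≤ m
      shortest₂ m w with π₂-walk w
      ... | l , w′ , l≤m = ≤-trans (shortestH l w′) l≤m

  ⊠-dist-from : ∀ {s w v e f} → IsDist G s (π₁ v) e → IsDist H w (π₂ v) f →
                IsDist (G ⊠ H) (combine s w) v (e ⊔ f)
  ⊠-dist-from {s} {w} dG dH =
    ⊠-dist (subst (λ x → IsDist G x _ _) (sym (cong proj₁ (Fin.remQuot-combine s w))) dG)
           (subst (λ x → IsDist H x _ _) (sym (cong proj₂ (Fin.remQuot-combine s w))) dH)

Resolves : (G : Graph) → (s x y : Fin (order G)) → Set
Resolves G s x y = ∃ λ d₁ → ∃ λ d₂ → IsDist G s x d₁ × IsDist G s y d₂ × d₁ ≢ d₂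

Resolves-sym : ∀ {G s x y} → Resolves G s x y → Resolves G s y x
Resolves-sym (d₁ , d₂ , dx , dy , d₁≢d₂) = d₂ , d₁ , dy , dx , d₁≢d₂ ∘ sym

IsLocalMetricGenerator-nonempty : ∀ {G S} → IsLocalMetricGenerator G S →
                                  (∃ λ x → ∃ λ y → Adj G x y) → ∃ λ s → s ∈ S
IsLocalMetricGenerator-nonempty gen (x , y , x~y) with gen x y x~y
... | s , s∈S , _ = s , s∈S

-- S × V(H), laid out along the encoding combine of the vertices of G ⊠ H.
cylinder : ∀ {n₁} n₂ → Subset n₁ → Subset (n₁ * n₂)
cylinder n₂ S = concat (map (replicate n₂) S)

combine-∈-cylinder : ∀ {n₁ n₂} {S : Subset n₁} {s} (w : Fin n₂) → s ∈ S →
                     combine s w ∈ cylinder n₂ S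
combine-∈-cylinder {n₂ = n₂} {S} {s} w s∈S = Vec.lookup⇒[]= (combine s w) _ (begin
  lookup (cylinder n₂ S) (combine s w)       ≡⟨ Vec.lookup-concat (map (replicate n₂) S) s w ⟩
  lookup (lookup (map (replicate n₂) S) s) w ≡⟨ cong (λ xs → lookup xs w) (Vec.lookup-map s (replicate n₂) S) ⟩
  lookup (replicate n₂ (lookup S s)) w       ≡⟨ Vec.lookup-replicate w (lookup S s) ⟩
  lookup S s                                 ≡⟨ Vec.[]=⇒lookup s∈S ⟩
  inside                                     ∎)
  where open ≡-Reasoning

∣p++q∣ : ∀ {m n} (p : Subset m) (q : Subset n) → ∣ p ++ q ∣ ≡ ∣ p ∣ + ∣ q ∣
∣p++q∣ []            q = refl
∣p++q∣ (inside  ∷ p) q = cong suc (∣p++q∣ p q)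
∣p++q∣ (outside ∷ p) q = ∣p++q∣ p q

∣cylinder∣ : ∀ {n₁} n₂ (S : Subset n₁) → ∣ cylinder n₂ S ∣ ≡ n₂ * ∣ S ∣
∣cylinder∣ n₂ []            = sym (*-zeroʳ n₂)
∣cylinder∣ n₂ (inside  ∷ S) = begin
  ∣ replicate n₂ inside ++ cylinder n₂ S ∣ ≡⟨ ∣p++q∣ (replicate n₂ inside) (cylinder n₂ S) ⟩
  ∣ replicate n₂ inside ∣ + ∣ cylinder n₂ S ∣ ≡⟨ cong₂ _+_ (∣⊤∣≡n n₂) (∣cylinder∣ n₂ S) ⟩
  n₂ + n₂ * ∣ S ∣                            ≡⟨ sym (*-suc n₂ ∣ S ∣) ⟩
  n₂ * suc ∣ S ∣                             ∎
  where open ≡-Reasoning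
∣cylinder∣ n₂ (outside ∷ S) =
  trans (∣p++q∣ (replicate n₂ outside) (cylinder n₂ S))
        (cong₂ _+_ (∣⊥∣≡0 n₂) (∣cylinder∣ n₂ S))

IsDiameter-dist< : ∀ {G D k} → IsDiameter G D → D < k → IsSimpleConnected G →
                   ∀ s x → ∃ λ e → IsDist G s x e × e < k
IsDiameter-dist< (_ , bounded) D<k sc s x with IsDist-exists sc s x
... | e , sx = e , sx , ≤-<-trans (bounded s x e sx) D<k

module _ {k : ℕ} {G H : Graph} (scH : IsSimpleConnected H) (resolved : AdjacencyResolved k H) where
  open Strong G H

  module _ {s : Fin (order G)} (close : ∀ x → ∃ λ e → IsDist G s x e × e < k) where

    resolves-via-far-vertex : ∀ {w u v} → Adj H (π₂ u) (π₂ v) →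
      (∃ λ δ → IsDist H (π₂ v) w δ × k ≤ δ) → InInterval H (π₂ u) (π₂ v) w →
      Resolves (G ⊠ H) (combine s w) u v
    resolves-via-far-vertex {w} {u} {v} b~d (δ , dw , k≤δ) b∈I
      with IsDist-interval scH b~d b∈I | close (π₁ u) | close (π₁ v)
    ... | β , bw , dw′ | e₁ , su , e₁<k | e₂ , sv , e₂<k =
      β , suc β ,
      subst (IsDist (G ⊠ H) _ u) (m≤n⇒m⊔n≡n e₁≤β)   (⊠-dist-from su (IsDist-sym sym-H bw)) ,
      subst (IsDist (G ⊠ H) _ v) (m≤n⇒m⊔n≡n e₂≤1+β) (⊠-dist-from sv (IsDist-sym sym-H dw′)) ,
      1+n≢n ∘ sym
      where
        sym-H : ∀ {x y} → Adj H x y → Adj H y x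
        sym-H = IsSimpleConnected.adj-sym scH
        k≤1+β : k ≤ suc β
        k≤1+β = subst (k ≤_) (IsDist-functional dw dw′) k≤δ
        e₁≤β : e₁ ≤ β
        e₁≤β = s≤s⁻¹ (≤-trans e₁<k k≤1+β)
        e₂≤1+β : e₂ ≤ suc β
        e₂≤1+β = <⇒≤ (≤-trans e₂<k k≤1+β)

    cylinder-resolves-across-H : ∀ {S} → s ∈ S → ∀ u v → Adj H (π₂ u) (π₂ v) →
      ∃ λ t → t ∈ cylinder (order H) S × Resolves (G ⊠ H) t u v
    cylinder-resolves-across-H s∈S u v b~d with resolved (π₂ u) (π₂ v) b~d
    ... | w , inj₁ (far , b∈I) =
      combine s w , combine-∈-cylinder w s∈S , resolves-via-far-vertex b~d far b∈I
    ... | w , inj₂ (far , d∈I) =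
      combine s w , combine-∈-cylinder w s∈S ,
      Resolves-sym (resolves-via-far-vertex (IsSimpleConnected.adj-sym scH b~d) far d∈I)

  resolves-along-G : ∀ {s} u v → π₂ u ≡ π₂ v → Resolves G s (π₁ u) (π₁ v) →
                     Resolves (G ⊠ H) (combine s (π₂ u)) u v
  resolves-along-G u v b≡d (d₁ , d₂ , s-a , s-c , d₁≢d₂) =
    d₁ , d₂ ,
    subst (IsDist (G ⊠ H) _ u) (⊔-identityʳ d₁) (⊠-dist-from s-a (IsDist-refl _)) ,
    subst (IsDist (G ⊠ H) _ v) (⊔-identityʳ d₂)
      (⊠-dist-from s-c (subst (λ b → IsDist H (π₂ u) b 0) b≡d (IsDist-refl _))) ,
    d₁≢d₂

  cylinder-isLocalMetricGenerator : ∀ {S s} → IsLocalMetricGenerator G S → s ∈ S →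
    (∀ x → ∃ λ e → IsDist G s x e × e < k) →
    IsLocalMetricGenerator (G ⊠ H) (cylinder (order H) S)
  cylinder-isLocalMetricGenerator gen s∈S close u v (same₁ _ b~d) =
    cylinder-resolves-across-H close s∈S u v b~d
  cylinder-isLocalMetricGenerator gen s∈S close u v (both _ b~d) =
    cylinder-resolves-across-H close s∈S u v b~d
  cylinder-isLocalMetricGenerator gen s∈S close u v (same₂ b≡d a~c) with gen (π₁ u) (π₁ v) a~c
  ... | t , t∈S , t-resolves =
    combine t (π₂ u) , combine-∈-cylinder (π₂ u) t∈S , resolves-along-G u v b≡d t-resolves

theorem5 : (k : ℕ) (G H : Graph) →
    IsSimpleConnected G → IsSimpleConnected H →
    AdjacencyResolved k H →
    order G ≥ 2 →
    (∃ λ D → IsDiameter G D × D < k) →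
    ∀ m₁ m₂ → IsLocalMetricDim G m₁ → IsLocalMetricDim (G ⊠ H) m₂ →
    m₂ ≤ order H * m₁
theorem5 k G H scG scH resolved 2≤n (D , diameter , D<k) m₁ m₂ ((S , gen , ∣S∣≡m₁) , _) (_ , minimal)
  with IsLocalMetricGenerator-nonempty gen (edge-exists scG 2≤n)
... | s , s∈S = begin
  m₂                       ≤⟨ minimal _ (cylinder-isLocalMetricGenerator scH resolved gen s∈S close) ⟩
  ∣ cylinder (order H) S ∣ ≡⟨ ∣cylinder∣ (order H) S ⟩
  order H * ∣ S ∣          ≡⟨ cong (order H *_) ∣S∣≡m₁ ⟩
  order H * m₁             ∎
  where
    open ≤-Reasoning
    close : ∀ x → ∃ λ e → IsDist G s x e × e < k
    close = IsDiameter-dist< diameter D<k scG s
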